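{- There are infinitely many integer bases $b\ge 2$ for which there exists a positive integer $A$ such that, in base $b$, $A\times A^{*}$ is a palindrome but $(A,A^{*})$ is not a polynomial pair.
   Context: Fix an integer base $b\ge2$. For a positive integer $A$ with base-$b$ representation $A=\sum_{i=0}^{a} a_i b^i$ (digits $a_i\in\{0,\dots,b-1\}$, $a_a\neq0$), let $P_b(A,x)=\sum_{i=0}^a a_ix^i$ and let the base-$b$ reversal be $A^{*}=\sum_{i=0}^a a_i b^{a-i}$. An integer $C$ is a (base-$b$) palindrome if $C=C^{*}$. A pair $(A,B)$ of positive integers is a (base-$b$) polynomial pair if $P_b(A,x)P_b(B,x)=P_b(A\times B,x)$. -}

module Defs where

open import Data.Nat using (ℕ; zero; suc; _+_; _*_; _<_; _≤_)
open import Data.Nat.DivMod using (_/_; _%_)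
open import Data.List using (List; []; _∷_; reverse; map)
open import Data.Product using (_×_; Σ)
open import Relation.Binary.PropositionalEquality using (_≡_)
open import Relation.Nullary using (¬_)

-- base-b digits of n, least significant first (the list [a_0, ..., a_a]).
-- Fuel-bounded; fuel n suffices for every base b ≥ 2 since each step
-- strictly decreases the number.  Base 0 is junk (only b ≥ 2 is used).
digitsF : ℕ → ℕ → ℕ → List ℕ
digitsF zero    b       n       = []
digitsF (suc f) b       zero    = []
digitsF (suc f) zero    (suc n) = []
digitsF (suc f) (suc c) (suc n) = (suc n % suc c) ∷ digitsF f (suc c) (suc n / suc c)

digits : ℕ → ℕ → List ℕ
digits b n = digitsF n b n

fromDigits : ℕ → List ℕ → ℕ
fromDigits b []       = 0
fromDigits b (d ∷ ds) = d + b * fromDigits b ds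

rev : ℕ → ℕ → ℕ
rev b A = fromDigits b (reverse (digits b A))

Palindrome : ℕ → ℕ → Set
Palindrome b C = C ≡ rev b C

-- polynomials with ℕ coefficients as coefficient lists (constant term first)
addP : List ℕ → List ℕ → List ℕ
addP []       q        = q
addP (a ∷ p)  []       = a ∷ p
addP (a ∷ p)  (c ∷ q)  = (a + c) ∷ addP p q

mulP : List ℕ → List ℕ → List ℕ
mulP []       q = []
mulP (a ∷ p)  q = addP (map (a *_) q) (0 ∷ mulP p q)

coeff : ℕ → List ℕ → ℕ
coeff i       []       = 0
coeff zero    (a ∷ p)  = a
coeff (suc i) (a ∷ p)  = coeff i p

Pb : ℕ → ℕ → List ℕ
Pb b A = digits b A

-- (A,B) is a base-b polynomial pair: P_b(A,x) P_b(B,x) = P_b(A×B,x)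
-- (equality of polynomials = equality of all coefficients)
PolyPair : ℕ → ℕ → ℕ → Set
PolyPair b A B = ∀ i → coeff i (mulP (Pb b A) (Pb b B)) ≡ coeff i (Pb b (A * B))

module Submission where

-- Idea (one base for every lower bound N).  Take A = N + 2 and the base
-- b = A² − 1, so that A² = 1 + 1·b.  Then
--   * A < b is a single nonzero digit, hence A* = A;
--   * A × A* = A² = 1 + 1·b has the digits "11", a palindrome;
--   * but P_b(A,x)·P_b(A*,x) is the constant polynomial A², whose constant
--     coefficient A² differs from the units digit 1 of A² = A × A*.

open import Defs
open import Data.Nat using (ℕ; zero; suc; pred; _+_; _*_; _<_; _≤_; z≤n; s≤s; NonZero)
open import Data.Nat.Properties using (+-identityʳ; *-zeroʳ; *-comm; m≤n+m; m<m*n; m≤m*n; <⇒≤; ≤-refl; <⇒≤pred; ≤-trans; <-≤-trans; <-trans)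
open import Data.Nat.DivMod using (_/_; _%_; [m+kn]%n≡m%n; m<n⇒m%n≡m; m<n⇒m/n≡0; +-distrib-/-∣ʳ; m*n/n≡m)
open import Data.Nat.Divisibility using (divides-refl)
open import Data.Nat.Tactic.RingSolver using (solve-∀)
open import Data.List using ([]; _∷_; reverse)
open import Data.Product using (Σ; _×_; _,_)
open import Relation.Nullary using (¬_)
open import Relation.Binary.PropositionalEquality using (_≡_; refl; sym; trans; cong; cong₂; module ≡-Reasoning)

digitsF-zero : ∀ f b → digitsF f b 0 ≡ []
digitsF-zero zero    b = refl
digitsF-zero (suc f) b = refl

digitsF-digit : ∀ f b d → 0 < d → d ≤ f → d < b → digitsF f b d ≡ d ∷ []
digitsF-digit zero    b       (suc d) _ () _
digitsF-digit (suc f) (suc c) (suc d) _ _  d<b =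
  cong₂ _∷_ (m<n⇒m%n≡m d<b)
            (trans (cong (digitsF f (suc c)) (m<n⇒m/n≡0 d<b)) (digitsF-zero f (suc c)))

digits-digit : ∀ b d → 0 < d → d < b → digits b d ≡ d ∷ []
digits-digit b d 0<d d<b = digitsF-digit d b d 0<d ≤-refl d<b

digits-step : ∀ b n .{{_ : NonZero b}} → 0 < n →
              digits b n ≡ n % b ∷ digitsF (pred n) b (n / b)
digits-step (suc c) (suc m) _ = refl

digits-two-digits : ∀ b d₀ d₁ → d₀ < b → 0 < d₁ → d₁ < b →
                    digits b (d₀ + d₁ * b) ≡ d₀ ∷ d₁ ∷ []
digits-two-digits b@(suc _) d₀ d₁@(suc _) d₀<b 0<d₁ d₁<b = begin
  digits b n                         ≡⟨ digits-step b n (<-trans 0<d₁ d₁<n) ⟩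
  n % b ∷ digitsF (pred n) b (n / b) ≡⟨ cong₂ _∷_ low-digit (cong (digitsF (pred n) b) high-part) ⟩
  d₀ ∷ digitsF (pred n) b d₁         ≡⟨ cong (d₀ ∷_) (digitsF-digit (pred n) b d₁ 0<d₁ d₁≤pred-n d₁<b) ⟩
  d₀ ∷ d₁ ∷ []                       ∎
  where
  open ≡-Reasoning
  n : ℕ
  n = d₀ + d₁ * b
  low-digit : n % b ≡ d₀
  low-digit = trans ([m+kn]%n≡m%n d₀ d₁ b) (m<n⇒m%n≡m d₀<b)
  high-part : n / b ≡ d₁
  high-part = trans (+-distrib-/-∣ʳ d₀ (divides-refl d₁))
                    (cong₂ _+_ (m<n⇒m/n≡0 d₀<b) (m*n/n≡m d₁ b))
  d₁<n : d₁ < n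
  d₁<n = <-≤-trans (m<m*n d₁ b (≤-trans (s≤s 0<d₁) d₁<b)) (m≤n+m (d₁ * b) d₀)
  d₁≤pred-n : d₁ ≤ pred n
  d₁≤pred-n = <⇒≤pred d₁<n

rev-digit : ∀ b d → 0 < d → d < b → rev b d ≡ d
rev-digit b d 0<d d<b = begin
  rev b d    ≡⟨ cong (λ ds → fromDigits b (reverse ds)) (digits-digit b d 0<d d<b) ⟩
  d + b * 0  ≡⟨ cong (d +_) (*-zeroʳ b) ⟩
  d + 0      ≡⟨ +-identityʳ d ⟩
  d          ∎
  where open ≡-Reasoning

palindrome-repdigit : ∀ b d → 0 < d → d < b → Palindrome b (d + d * b)
palindrome-repdigit b d 0<d d<b = sym (begin
  rev b (d + d * b)    ≡⟨ cong (λ ds → fromDigits b (reverse ds)) (digits-two-digits b d d d<b 0<d d<b) ⟩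
  d + b * (d + b * 0)  ≡⟨ cong (λ z → d + b * z) (trans (cong (d +_) (*-zeroʳ b)) (+-identityʳ d)) ⟩
  d + b * d            ≡⟨ cong (d +_) (*-comm b d) ⟩
  d + d * b            ∎)
  where open ≡-Reasoning

coeff₀-mulP : ∀ p q → coeff 0 (mulP p q) ≡ coeff 0 p * coeff 0 q
coeff₀-mulP []      q       = refl
coeff₀-mulP (a ∷ p) []      = sym (*-zeroʳ a)
coeff₀-mulP (a ∷ p) (c ∷ q) = +-identityʳ (a * c)

coeff₀-digits : ∀ b n .{{_ : NonZero b}} → coeff 0 (digits b n) ≡ n % b
coeff₀-digits (suc c) zero    = refl
coeff₀-digits (suc c) (suc m) = refl

polyPair⇒units-digits : ∀ b A B .{{_ : NonZero b}} → PolyPair b A B →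
                        (A % b) * (B % b) ≡ (A * B) % b
polyPair⇒units-digits b A B pp = begin
  (A % b) * (B % b)                       ≡⟨ sym (cong₂ _*_ (coeff₀-digits b A) (coeff₀-digits b B)) ⟩
  coeff 0 (Pb b A) * coeff 0 (Pb b B)     ≡⟨ sym (coeff₀-mulP (Pb b A) (Pb b B)) ⟩
  coeff 0 (mulP (Pb b A) (Pb b B))        ≡⟨ pp 0 ⟩
  coeff 0 (Pb b (A * B))                  ≡⟨ coeff₀-digits b (A * B) ⟩
  (A * B) % b                             ∎
  where open ≡-Reasoning

square-eleven-witness : ∀ b A → 2 ≤ A → A < b → A * A ≡ 1 + 1 * b →
                        Palindrome b (A * rev b A) × ¬ PolyPair b A (rev b A)
square-eleven-witness b@(suc _) A@(suc (suc _)) (s≤s (s≤s z≤n)) A<b A²≡11 = palindrome , not-poly-pair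
  where
  open ≡-Reasoning
  rev-A : rev b A ≡ A
  rev-A = rev-digit b A (s≤s z≤n) A<b
  palindrome : Palindrome b (A * rev b A)
  palindrome = begin
    A * rev b A             ≡⟨ cong (A *_) rev-A ⟩
    A * A                   ≡⟨ A²≡11 ⟩
    1 + 1 * b               ≡⟨ palindrome-repdigit b 1 (s≤s z≤n) (≤-trans (s≤s (s≤s z≤n)) A<b) ⟩
    rev b (1 + 1 * b)       ≡⟨ cong (rev b) (sym A²≡11) ⟩
    rev b (A * A)           ≡⟨ cong (λ z → rev b (A * z)) (sym rev-A) ⟩
    rev b (A * rev b A)     ∎
  not-poly-pair : ¬ PolyPair b A (rev b A)
  not-poly-pair pp with begin
    A * A                   ≡⟨ sym (cong₂ _*_ (m<n⇒m%n≡m A<b) (m<n⇒m%n≡m A<b)) ⟩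
    (A % b) * (A % b)       ≡⟨ cong (λ z → (A % b) * (z % b)) (sym rev-A) ⟩
    (A % b) * (rev b A % b) ≡⟨ polyPair⇒units-digits b A (rev b A) pp ⟩
    (A * rev b A) % b       ≡⟨ cong (λ z → (A * z) % b) rev-A ⟩
    (A * A) % b             ≡⟨ cong (_% b) A²≡11 ⟩
    (1 + 1 * b) % b         ≡⟨ [m+kn]%n≡m%n 1 1 b ⟩
    1 % b                   ≡⟨ m<n⇒m%n≡m (≤-trans (s≤s (s≤s z≤n)) A<b) ⟩
    1                       ∎
  ... | ()

-- Every lower bound N is beaten by the base b = (N+2)² − 1 = 3 + N(N+4),
-- with witness A = N + 2.
proposition12 : (N : ℕ) → Σ ℕ (λ b → N ≤ b × 2 ≤ b ×
                  Σ ℕ (λ A → 0 < A × Palindrome b (A * rev b A) × ¬ PolyPair b A (rev b A)))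
proposition12 N = b , N≤b , s≤s (s≤s z≤n) , A , s≤s z≤n ,
                  square-eleven-witness b A (s≤s (s≤s z≤n)) A<b (square-identity N)
  where
  A b : ℕ
  A = 2 + N
  b = 3 + N * (4 + N)
  square-identity : ∀ n → (2 + n) * (2 + n) ≡ 1 + 1 * (3 + n * (4 + n))
  square-identity = solve-∀
  A<b : A < b
  A<b = s≤s (s≤s (s≤s (m≤m*n N (4 + N))))
  N≤b : N ≤ b
  N≤b = ≤-trans (m≤n+m N 2) (<⇒≤ A<b)
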